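{- Let $G$ be a triangle-free graph in which every vertex has odd degree. Then the complement $\overline{G}$ has an odd spanning tree if and only if $G$ is not isomorphic to $2K_2$ and $G$ is not a complete bipartite graph.
   Context: All graphs are finite and simple. The complement $\overline{G}$ has vertex set $V(G)$, two vertices being adjacent in $\overline{G}$ iff they are not adjacent in $G$. An odd spanning tree is a spanning tree in which every vertex has odd degree. $2K_2$ denotes the graph consisting of two vertex-disjoint edges (the complement of the $4$-cycle $C_4$). A complete bipartite graph is $K_{s,t}$ for positive integers $s,t$. -}

module Defs where

open import Data.Nat using (ℕ; suc; _+_; _<ᵇ_; _≤_; _%_)
open import Data.Fin using (Fin; toℕ; _≟_)
open import Data.Bool using (Bool; true; false; not; _∧_; _xor_; T)
open import Data.List using (List; []; _∷_; length; filter; _∷ʳ_; allFin)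
open import Data.List.Relation.Unary.Unique.Propositional using (Unique)
open import Data.List.Relation.Unary.Linked using (Linked)
open import Data.Product using (Σ; ∃; _×_; _,_)
open import Relation.Nullary using (¬_; does)
open import Relation.Binary.PropositionalEquality using (_≡_)
open import Function.Bundles using (_⤖_; Bijection)

record Graph (n : ℕ) : Set where
  field
    adj     : Fin n → Fin n → Bool
    sym     : ∀ i j → adj i j ≡ adj j i
    irrefl  : ∀ i → adj i i ≡ false
open Graph public

Edge : ∀ {n} → Graph n → Fin n → Fin n → Set
Edge G i j = T (adj G i j)

degree : ∀ {n} → Graph n → Fin n → ℕ
degree {n} G i = length (filter (λ j → T? (adj G i j)) (allFin n))
  where
  open import Data.Bool.Properties using (T?)

Odd : ℕ → Set
Odd m = m % 2 ≡ 1

AllDegreesOdd : ∀ {n} → Graph n → Set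
AllDegreesOdd G = ∀ i → Odd (degree G i)

TriangleFree : ∀ {n} → Graph n → Set
TriangleFree G = ∀ a b c → ¬ (Edge G a b × Edge G b c × Edge G a c)

complement : ∀ {n} → Graph n → Graph n
complement {n} G = record
  { adj = λ i j → not (adj G i j) ∧ not (does (i ≟ j))
  ; sym = sym′
  ; irrefl = irr
  }
  where
  open import Relation.Binary.PropositionalEquality using (refl; cong₂; cong)
  open import Relation.Nullary using (yes; no)
  open import Data.Bool.Properties using (∧-zeroʳ)
  sym′ : ∀ i j → not (adj G i j) ∧ not (does (i ≟ j)) ≡ not (adj G j i) ∧ not (does (j ≟ i))
  sym′ i j with i ≟ j | j ≟ i
  ... | yes refl | yes _ = refl
  ... | yes refl | no ne = Data.Empty.⊥-elim (ne refl) where import Data.Empty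
  ... | no ne | yes refl = Data.Empty.⊥-elim (ne refl) where import Data.Empty
  ... | no _ | no _ = cong (λ b → not b ∧ true) (Graph.sym G i j)
  irr : ∀ i → not (adj G i i) ∧ not (does (i ≟ i)) ≡ false
  irr i with i ≟ i
  ... | yes _ = ∧-zeroʳ _
  ... | no ne = Data.Empty.⊥-elim (ne refl) where import Data.Empty

data Walk {n} (G : Graph n) : Fin n → Fin n → Set where
  here : ∀ {u} → Walk G u u
  step : ∀ {u v w} → Edge G u v → Walk G v w → Walk G u w

Connected : ∀ {n} → Graph n → Set
Connected G = ∀ u v → Walk G u v

-- a cycle: distinct vertices x, x₁, …, x_k (k ≥ 2), consecutive ones adjacent,
-- and x_k adjacent to x
HasCycle : ∀ {n} → Graph n → Set
HasCycle {n} G = Σ (Fin n) λ x → Σ (List (Fin n)) λ xs →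
  2 ≤ length xs × Unique (x ∷ xs) × Linked (Edge G) ((x ∷ xs) ∷ʳ x)

IsTree : ∀ {n} → Graph n → Set
IsTree G = Connected G × ¬ HasCycle G

SpanningSubgraph : ∀ {n} → Graph n → Graph n → Set
SpanningSubgraph T H = ∀ i j → Edge T i j → Edge H i j

HasOddSpanningTree : ∀ {n} → Graph n → Set
HasOddSpanningTree {n} H =
  Σ (Graph n) λ T → SpanningSubgraph T H × IsTree T × AllDegreesOdd T

Isomorphic : ∀ {m n} → Graph m → Graph n → Set
Isomorphic {m} {n} G H = Σ (Fin m ⤖ Fin n) λ f →
  ∀ i j → adj G i j ≡ adj H (Bijection.to f i) (Bijection.to f j)

twoK2 : Graph 4
twoK2 = record { adj = a ; sym = s ; irrefl = ir }
  where
  open import Relation.Binary.PropositionalEquality using (refl)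
  a : Fin 4 → Fin 4 → Bool
  a Fin.zero (Fin.suc Fin.zero) = true
  a (Fin.suc Fin.zero) Fin.zero = true
  a (Fin.suc (Fin.suc Fin.zero)) (Fin.suc (Fin.suc (Fin.suc Fin.zero))) = true
  a (Fin.suc (Fin.suc (Fin.suc Fin.zero))) (Fin.suc (Fin.suc Fin.zero)) = true
  a _ _ = false
  s : ∀ i j → a i j ≡ a j i
  s Fin.zero Fin.zero = refl
  s Fin.zero (Fin.suc Fin.zero) = refl
  s Fin.zero (Fin.suc (Fin.suc Fin.zero)) = refl
  s Fin.zero (Fin.suc (Fin.suc (Fin.suc Fin.zero))) = refl
  s (Fin.suc Fin.zero) Fin.zero = refl
  s (Fin.suc Fin.zero) (Fin.suc Fin.zero) = refl
  s (Fin.suc Fin.zero) (Fin.suc (Fin.suc Fin.zero)) = refl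
  s (Fin.suc Fin.zero) (Fin.suc (Fin.suc (Fin.suc Fin.zero))) = refl
  s (Fin.suc (Fin.suc Fin.zero)) Fin.zero = refl
  s (Fin.suc (Fin.suc Fin.zero)) (Fin.suc Fin.zero) = refl
  s (Fin.suc (Fin.suc Fin.zero)) (Fin.suc (Fin.suc Fin.zero)) = refl
  s (Fin.suc (Fin.suc Fin.zero)) (Fin.suc (Fin.suc (Fin.suc Fin.zero))) = refl
  s (Fin.suc (Fin.suc (Fin.suc Fin.zero))) Fin.zero = refl
  s (Fin.suc (Fin.suc (Fin.suc Fin.zero))) (Fin.suc Fin.zero) = refl
  s (Fin.suc (Fin.suc (Fin.suc Fin.zero))) (Fin.suc (Fin.suc Fin.zero)) = refl
  s (Fin.suc (Fin.suc (Fin.suc Fin.zero))) (Fin.suc (Fin.suc (Fin.suc Fin.zero))) = refl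
  ir : ∀ i → a i i ≡ false
  ir Fin.zero = refl
  ir (Fin.suc Fin.zero) = refl
  ir (Fin.suc (Fin.suc Fin.zero)) = refl
  ir (Fin.suc (Fin.suc (Fin.suc Fin.zero))) = refl

completeBipartite : (s t : ℕ) → Graph (s + t)
completeBipartite s t = record
  { adj = λ i j → (toℕ i <ᵇ s) xor (toℕ j <ᵇ s)
  ; sym = λ i j → xor-comm (toℕ i <ᵇ s) (toℕ j <ᵇ s)
  ; irrefl = λ i → xor-same (toℕ i <ᵇ s)
  }
  where
  open import Relation.Binary.PropositionalEquality using (refl)
  xor-comm : ∀ a b → a xor b ≡ b xor a
  xor-comm false false = refl
  xor-comm false true = refl
  xor-comm true false = refl
  xor-comm true true = refl
  xor-same : ∀ a → a xor a ≡ false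
  xor-same false = refl
  xor-same true = refl

IsCompleteBipartite : ∀ {n} → Graph n → Set
IsCompleteBipartite G = Σ ℕ λ s → Σ ℕ λ t →
  1 ≤ s × 1 ≤ t × Isomorphic G (completeBipartite s t)

-- Necessity: the complement of K_{s,t} is disconnected, and the complement of 2K₂ is a 4-cycle, whose
-- spanning trees are paths and so have vertices of degree 2.
--
-- Sufficiency: by the handshake lemma n is even. Call (v, x, p, ℓ) a configuration if v x is an edge
-- and p, ℓ are distinct non-neighbours of v with p adjacent to neither x nor ℓ. Given one, hang ℓ and x
-- from p, the other neighbours of v from x (legal in the complement since G is triangle-free) and the
-- remaining vertices from v. Then p has degree 3, x has degree deg v, v has n − 2 − deg v children,
-- and all other vertices are leaves, so every degree is odd. Without a configuration either G ≅ 2K₂,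
-- or every vertex lies on or next to every edge; a triangle-free graph with the latter property is
-- complete bipartite, its sides being the neighbours and the non-neighbours of any non-isolated vertex.

module Submission where

open import Defs renaming (sym to adj-sym; irrefl to adj-irrefl)
open import Data.Nat using (ℕ; zero; suc; _+_; _≤_; _<_; _<ᵇ_; parity; z≤n; s≤s)
open import Data.Nat.Properties
  using (+-0-commutativeMonoid; <⇒<ᵇ; <-trans; <-asym; <-irrefl; <-≤-trans; ≤-pred; n<1+n)
open import Data.Parity using (0ℙ; 1ℙ) renaming (_+_ to _⊕_)
import Data.Parity.Properties as ℙ
open import Data.Fin using (Fin; zero; suc; toℕ; _≟_; join; splitAt; _↑ʳ_)
open import Data.Fin.Patterns using (0F; 1F; 2F; 3F)
open import Data.Fin.Properties using (any?; toℕ-↑ˡ; toℕ-↑ʳ; toℕ<n; splitAt-join; join-splitAt)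
import Data.Bool as Bool
open import Data.Bool using (Bool; true; false; not; _∧_; _∨_; _xor_; T; if_then_else_)
open import Data.Bool.Properties using (T?; T-≡; ¬-not; not-injective; ∧-identityʳ; ∧-zeroʳ; ∨-comm)
open import Data.List using (List; []; _∷_; _∷ʳ_; length; filter; tabulate)
open import Data.List.Relation.Unary.All as All using (All; []; _∷_)
open import Data.List.Relation.Unary.All.Properties as All using ()
open import Data.List.Relation.Unary.AllPairs as AllPairs using (AllPairs; []; _∷_)
open import Data.List.Relation.Unary.Any as Any using (Any; here; there)
open import Data.List.Relation.Unary.Linked as Linked using (Linked; []; [-]; _∷_)
open import Data.List.Relation.Unary.Linked.Properties using (Linked⇒AllPairs)
open import Data.List.Relation.Unary.Unique.Propositional using (Unique)
open import Data.List.Relation.Unary.Unique.Propositional.Properties using (Unique[x∷xs]⇒x∉xs)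
open import Data.Product using (∃-syntax; _×_; _,_; proj₁; proj₂)
open import Data.Sum as Sum using (_⊎_; inj₁; inj₂)
open import Data.Empty using (⊥; ⊥-elim)
open import Data.Unit using (⊤; tt)
open import Function using (_∘_; id; flip)
open import Function.Bundles using (_⇔_; mk⇔; Equivalence; Bijection; mk↔ₛ′)
open import Function.Properties.Inverse using (↔⇒⤖)
open import Relation.Nullary using (¬_; ¬?; _×-dec_; Dec; does; yes; no)
open import Relation.Nullary.Decidable using (dec-true; dec-false; map′)
open import Relation.Binary.Definitions using (Transitive)
open import Relation.Binary.PropositionalEquality
  using (_≡_; _≢_; ≢-sym; refl; sym; trans; cong; cong₂; subst; _≗_; module ≡-Reasoning)
open import Algebra.Properties.CommutativeMonoid.Sum +-0-commutativeMonoid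
  using (sum; sum-cong-≗; ∑-distrib-+)

infix 4 _==_

_==_ : ∀ {n} → Fin n → Fin n → Bool
i == j = does (i ≟ j)

==-refl : ∀ {n} (i : Fin n) → (i == i) ≡ true
==-refl i = dec-true (i ≟ i) refl

==-≢ : ∀ {n} {i j : Fin n} → i ≢ j → (i == j) ≡ false
==-≢ {i = i} {j} = dec-false (i ≟ j)

==-sym : ∀ {n} (i j : Fin n) → (i == j) ≡ (j == i)
==-sym i j with i ≟ j | j ≟ i
... | yes _    | yes _    = refl
... | no _     | no _     = refl
... | yes refl | no j≢i   = ⊥-elim (j≢i refl)
... | no i≢j   | yes refl = ⊥-elim (i≢j refl)

bit : Bool → ℕ
bit false = 0
bit true  = 1

count : ∀ {n} → (Fin n → Bool) → ℕ
count f = sum (bit ∘ f)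

count-cong : ∀ {n} {f g : Fin n → Bool} → f ≗ g → count f ≡ count g
count-cong f≗g = sum-cong-≗ (cong bit ∘ f≗g)

count-false : ∀ {n} {f : Fin n → Bool} → (∀ i → f i ≡ false) → count f ≡ 0
count-false {zero}  f≡false = refl
count-false {suc n} f≡false
  rewrite f≡false zero = count-false {n} (f≡false ∘ suc)

count-true : ∀ n → count {n} (λ _ → true) ≡ n
count-true zero    = refl
count-true (suc n) = cong suc (count-true n)

count-∨ : ∀ {n} (f g : Fin n → Bool) → (∀ i → f i ∧ g i ≡ false) →
          count (λ i → f i ∨ g i) ≡ count f + count g
count-∨ f g disjoint = trans (sum-cong-≗ bit-∨) (∑-distrib-+ (bit ∘ f) (bit ∘ g))
  where
  bit-∨ : ∀ i → bit (f i ∨ g i) ≡ bit (f i) + bit (g i)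
  bit-∨ i with f i | g i | disjoint i
  ... | false | _     | _  = refl
  ... | true  | false | _  = refl
  ... | true  | true  | ()

count-singleton : ∀ {n} (a : Fin n) → count (_== a) ≡ 1
count-singleton {suc n} zero    = cong suc (count-false {n} (λ _ → refl))
count-singleton {suc n} (suc a) = count-singleton a

count-complement : ∀ {n} (f : Fin n → Bool) → count f + count (not ∘ f) ≡ n
count-complement {n} f =
  trans (sym (∑-distrib-+ (bit ∘ f) (bit ∘ not ∘ f))) (trans (sum-cong-≗ one) (count-true n))
  where
  one : ∀ i → bit (f i) + bit (not (f i)) ≡ 1
  one i with f i
  ... | true  = refl
  ... | false = refl

count-pair : ∀ {n} {a b : Fin n} → a ≢ b → count (λ j → (j == a) ∨ (j == b)) ≡ 2
count-pair {a = a} {b} a≢b =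
  trans (count-∨ (_== a) (_== b) disjoint) (cong₂ _+_ (count-singleton a) (count-singleton b))
  where
  disjoint : ∀ j → (j == a) ∧ (j == b) ≡ false
  disjoint j with j ≟ a
  ... | no _     = refl
  ... | yes refl = ==-≢ a≢b

count-remove : ∀ {n} (f : Fin n → Bool) {a} → f a ≡ true →
               count f ≡ suc (count (λ j → f j ∧ not (j == a)))
count-remove {n} f {a} fa =
  trans (count-cong split)
        (trans (count-∨ (_== a) f∖a disjoint) (cong (_+ count f∖a) (count-singleton a)))
  where
  f∖a : Fin n → Bool
  f∖a j = f j ∧ not (j == a)
  split : ∀ j → f j ≡ (j == a) ∨ f∖a j
  split j with j ≟ a
  ... | yes refl = fa
  ... | no _     = sym (∧-identityʳ (f j))
  disjoint : ∀ j → (j == a) ∧ f∖a j ≡ false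
  disjoint j with j ≟ a
  ... | yes refl = ∧-zeroʳ (f a)
  ... | no _     = refl

degree≡count : ∀ {n} (G : Graph n) i → degree G i ≡ count (adj G i)
degree≡count G i = length-filter (adj G i) id
  where
  length-filter : ∀ {m k} (f : Fin k → Bool) (h : Fin m → Fin k) →
                  length (filter (λ j → T? (f j)) (tabulate h)) ≡ count (f ∘ h)
  length-filter {zero}  f h = refl
  length-filter {suc m} f h with f (h zero)
  ... | true  = cong suc (length-filter f (h ∘ suc))
  ... | false = length-filter f (h ∘ suc)

Odd⇒parity≡1 : ∀ m → Odd m → parity m ≡ 1ℙ
Odd⇒parity≡1 1             _   = refl
Odd⇒parity≡1 (suc (suc m)) odd = Odd⇒parity≡1 m odd

parity≡1⇒Odd : ∀ m → parity m ≡ 1ℙ → Odd m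
parity≡1⇒Odd 1             _ = refl
parity≡1⇒Odd (suc (suc m)) p = parity≡1⇒Odd m p

even-+⇒≡parity : ∀ a b → parity (a + b) ≡ 0ℙ → parity a ≡ parity b
even-+⇒≡parity a b even with parity a | parity b | trans (sym (ℙ.+-homo-+ a b)) even
... | 0ℙ | 0ℙ | _ = refl
... | 1ℙ | 1ℙ | _ = refl

parity-suc-injective : ∀ a b → parity (suc a) ≡ parity (suc b) → parity a ≡ parity b
parity-suc-injective a b eq = ℙ.⁻¹-injective (trans (sym (ℙ.+-homo-+ 1 a)) (trans eq (ℙ.+-homo-+ 1 b)))

parity-∑-odd : ∀ {n} (g : Fin n → ℕ) → (∀ i → parity (g i) ≡ 1ℙ) → parity (sum g) ≡ parity n
parity-∑-odd {zero}  g odd = refl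
parity-∑-odd {suc n} g odd = begin
  parity (g zero + sum (g ∘ suc))         ≡⟨ ℙ.+-homo-+ (g zero) (sum (g ∘ suc)) ⟩
  parity (g zero) ⊕ parity (sum (g ∘ suc)) ≡⟨ cong₂ _⊕_ (odd zero) (parity-∑-odd (g ∘ suc) (odd ∘ suc)) ⟩
  1ℙ ⊕ parity n                            ≡⟨ ℙ.+-homo-+ 1 n ⟨
  parity (suc n)                           ∎
  where open ≡-Reasoning

-- Row 0 and column 0 of the adjacency matrix both count c, so removing vertex 0 removes 2c.
handshake : ∀ {n} (a : Fin n → Fin n → Bool) →
  (∀ i j → a i j ≡ a j i) → (∀ i → a i i ≡ false) → parity (sum (λ i → count (a i))) ≡ 0ℙ
handshake {zero}  a a-sym a-irr = refl
handshake {suc n} a a-sym a-irr = begin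
  parity (bit (a zero zero) + c + rows)
    ≡⟨ cong (λ b → parity (bit b + c + rows)) (a-irr zero) ⟩
  parity (c + rows)
    ≡⟨ cong (λ s → parity (c + s)) (∑-distrib-+ (bit ∘ flip a zero ∘ suc) (λ i → count (a (suc i) ∘ suc))) ⟩
  parity (c + (count (flip a zero ∘ suc) + rest))
    ≡⟨ cong (λ c′ → parity (c + (c′ + rest))) (count-cong (λ i → a-sym (suc i) zero)) ⟩
  parity (c + (c + rest))
    ≡⟨ trans (ℙ.+-homo-+ c (c + rest)) (cong (parity c ⊕_) (ℙ.+-homo-+ c rest)) ⟩
  parity c ⊕ (parity c ⊕ parity rest)
    ≡⟨ trans (sym (ℙ.+-assoc (parity c) (parity c) (parity rest)))
             (cong (_⊕ parity rest) (ℙ.p+p≡0ℙ (parity c))) ⟩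
  parity rest
    ≡⟨ handshake (λ i j → a (suc i) (suc j)) (λ i j → a-sym (suc i) (suc j)) (a-irr ∘ suc) ⟩
  0ℙ ∎
  where
  open ≡-Reasoning
  c rows rest : ℕ
  c    = count (a zero ∘ suc)
  rows = sum (λ i → bit (a (suc i) zero) + count (a (suc i) ∘ suc))
  rest = sum (λ i → count (a (suc i) ∘ suc))

even-order : ∀ {n} (G : Graph n) → AllDegreesOdd G → parity n ≡ 0ℙ
even-order {n} G odd = trans (sym (parity-∑-odd (λ i → count (adj G i)) parity-deg))
                             (handshake (adj G) (adj-sym G) (adj-irrefl G))
  where
  parity-deg : ∀ i → parity (count (adj G i)) ≡ 1ℙ
  parity-deg i = subst (λ d → parity d ≡ 1ℙ) (degree≡count G i) (Odd⇒parity≡1 (degree G i) (odd i))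

module _ {n} {G : Graph n} where

  Edge-sym : ∀ {u v} → Edge G u v → Edge G v u
  Edge-sym {u} {v} = subst T (adj-sym G u v)

  _◅◅_ : ∀ {u v w} → Walk G u v → Walk G v w → Walk G u w
  here     ◅◅ q = q
  step e p ◅◅ q = step e (p ◅◅ q)

  reverse : ∀ {u v} → Walk G u v → Walk G v u
  reverse here       = here
  reverse (step e p) = reverse p ◅◅ step (Edge-sym e) here

  walk-preserves : (P : Fin n → Set) → (∀ {i j} → P i → Edge G i j → P j) →
                   ∀ {u v} → P u → Walk G u v → P v
  walk-preserves P closed pu here       = pu
  walk-preserves P closed pu (step e p) = walk-preserves P closed (closed pu e) p

NonBacktracking : ∀ {A : Set} → List A → Set
NonBacktracking (a ∷ b ∷ c ∷ l) = a ≢ c × NonBacktracking (b ∷ c ∷ l)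
NonBacktracking _               = ⊤

LastStep : ∀ {A : Set} → (A → A → Set) → List A → Set
LastStep R (a ∷ b ∷ [])    = R a b
LastStep R (a ∷ b ∷ c ∷ l) = LastStep R (b ∷ c ∷ l)
LastStep R _               = ⊥

module _ {A : Set} where

  nonBacktracking-∷ʳ : ∀ {z : A} (l : List A) →
                       AllPairs _≢_ l → All (_≢ z) l → NonBacktracking (l ∷ʳ z)
  nonBacktracking-∷ʳ []              _                      _         = tt
  nonBacktracking-∷ʳ (a ∷ [])        _                      _         = tt
  nonBacktracking-∷ʳ (a ∷ b ∷ [])    _                      (a≢z ∷ _) = a≢z , tt
  nonBacktracking-∷ʳ (a ∷ b ∷ c ∷ l) ((_ ∷ a≢c ∷ _) ∷ apart) (_ ∷ ≢z)  =
    a≢c , nonBacktracking-∷ʳ (b ∷ c ∷ l) apart ≢z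

  nonBacktracking-cycle : ∀ {x y y′ : A} ys → Unique (x ∷ y ∷ y′ ∷ ys) →
                          NonBacktracking (x ∷ y ∷ y′ ∷ ys ∷ʳ x)
  nonBacktracking-cycle ys ((x≢y ∷ x≢y′ ∷ x≢ys) ∷ distinct) =
    x≢y′ , nonBacktracking-∷ʳ (_ ∷ _ ∷ ys) distinct (All.map ≢-sym (x≢y ∷ x≢y′ ∷ x≢ys))

  Linked⇒LastStep : ∀ {R : A → A → Set} {a b} l → Linked R (a ∷ b ∷ l) → LastStep R (a ∷ b ∷ l)
  Linked⇒LastStep []      (r ∷ [-]) = r
  Linked⇒LastStep (c ∷ l) (_ ∷ rs)  = Linked⇒LastStep l rs

  LastStep-∷ʳ : ∀ {R : A → A → Set} {e} a b l →
                LastStep R (a ∷ b ∷ l ∷ʳ e) → Any (λ u → R u e) (b ∷ l)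
  LastStep-∷ʳ a b []      r = here r
  LastStep-∷ʳ a b (c ∷ l) r = there (LastStep-∷ʳ b c l r)

  ¬Linked-closed : ∀ {R : A → A → Set} → Transitive R → (∀ {a} → ¬ R a a) →
                   ∀ x l → ¬ Linked R (x ∷ l ∷ʳ x)
  ¬Linked-closed trans irrefl x l linked =
    irrefl (proj₂ (All.∷ʳ⁻ (AllPairs.head (Linked⇒AllPairs trans linked))))

-- Trees given by a parent function

module ParentTree {n} (root : Fin n) (parent : Fin n → Fin n) (rank : Fin n → ℕ)
                  (rank-parent : ∀ c → c ≢ root → rank (parent c) < rank c) where

  isChildOf : Fin n → Fin n → Bool
  isChildOf c u = not (c == root) ∧ (parent c == u)

  Child : Fin n → Fin n → Set
  Child c u = c ≢ root × parent c ≡ u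

  isChildOf⇒Child : ∀ {c u} → isChildOf c u ≡ true → Child c u
  isChildOf⇒Child {c} {u} _ with c ≟ root | parent c ≟ u
  isChildOf⇒Child () | yes _    | _
  isChildOf⇒Child () | no _     | no _
  isChildOf⇒Child _  | no c≢r   | yes pc≡u = c≢r , pc≡u

  Child⇒isChildOf : ∀ {c u} → Child c u → isChildOf c u ≡ true
  Child⇒isChildOf {c} (c≢r , refl) rewrite ==-≢ c≢r | ==-refl (parent c) = refl

  Child⇒rank< : ∀ {c u} → Child c u → rank u < rank c
  Child⇒rank< {c} (c≢r , refl) = rank-parent c c≢r

  isChildOf-asym : ∀ c u → isChildOf c u ∧ isChildOf u c ≡ false
  isChildOf-asym c u with isChildOf c u in cu | isChildOf u c in uc
  ... | false | _     = refl
  ... | true  | false = refl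
  ... | true  | true  =
    ⊥-elim (<-asym (Child⇒rank< (isChildOf⇒Child cu)) (Child⇒rank< (isChildOf⇒Child uc)))

  isChildOf-irrefl : ∀ c → isChildOf c c ≡ false
  isChildOf-irrefl c with isChildOf c c in cc
  ... | false = refl
  ... | true  = ⊥-elim (<-irrefl refl (Child⇒rank< (isChildOf⇒Child cc)))

  tree : Graph n
  tree = record
    { adj    = λ i j → isChildOf i j ∨ isChildOf j i
    ; sym    = λ i j → ∨-comm (isChildOf i j) (isChildOf j i)
    ; irrefl = λ i → cong₂ _∨_ (isChildOf-irrefl i) (isChildOf-irrefl i)
    }

  Edge⇒Child : ∀ {a b} → Edge tree a b → Child a b ⊎ Child b a
  Edge⇒Child {a} {b} e with isChildOf a b in ab | isChildOf b a in ba
  ... | true  | _    = inj₁ (isChildOf⇒Child ab)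
  ... | false | true = inj₂ (isChildOf⇒Child ba)

  Child⇒Edge : ∀ {a b} → Child a b → Edge tree a b
  Child⇒Edge {a} {b} ab rewrite Child⇒isChildOf ab = tt

  walk-to-root : ∀ k c → rank c < k → Walk tree c root
  walk-to-root (suc k) c rank<k with c ≟ root
  ... | yes refl = here
  ... | no c≢r   = step (Child⇒Edge (c≢r , refl))
                        (walk-to-root k (parent c) (<-≤-trans (rank-parent c c≢r) (≤-pred rank<k)))

  connected : Connected tree
  connected u v = walk-to-root _ u (n<1+n _) ◅◅ reverse (walk-to-root _ v (n<1+n _))

  -- A non-backtracking walk that once steps away from the root keeps doing so.
  child-after-ascent : ∀ {a b c} → Child b a → Edge tree b c → a ≢ c → Child c b
  child-after-ascent (_ , pb≡a) e a≢c with Edge⇒Child e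
  ... | inj₁ (_ , pb≡c) = ⊥-elim (a≢c (trans (sym pb≡a) pb≡c))
  ... | inj₂ c-child    = c-child

  ascent-continues : ∀ {a b} l → Linked (Edge tree) (a ∷ b ∷ l) → NonBacktracking (a ∷ b ∷ l) →
                     Child b a → Linked (flip Child) (a ∷ b ∷ l)
  ascent-continues []      _           _          b-child = b-child ∷ [-]
  ascent-continues (c ∷ l) (_ ∷ links) (a≢c , nb) b-child =
    b-child ∷ ascent-continues l links nb (child-after-ascent b-child (Linked.head links) a≢c)

  descends-or-ends-ascending : ∀ {a b} l →
                               Linked (Edge tree) (a ∷ b ∷ l) → NonBacktracking (a ∷ b ∷ l) →
                               Linked Child (a ∷ b ∷ l) ⊎ LastStep (flip Child) (a ∷ b ∷ l)
  descends-or-ends-ascending []      (e ∷ [-]) _ = Sum.map (_∷ [-]) id (Edge⇒Child e)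
  descends-or-ends-ascending (c ∷ l) (e ∷ links) (a≢c , nb) with descends-or-ends-ascending l links nb
  ... | inj₂ ends-ascending = inj₂ ends-ascending
  ... | inj₁ descent with Edge⇒Child e
  ...   | inj₁ a-child = inj₁ (a-child ∷ descent)
  ...   | inj₂ b-child =
    inj₂ (Linked⇒LastStep (c ∷ l) (ascent-continues (c ∷ l) (e ∷ links) (a≢c , nb) b-child))

  ¬rank-increasing-closed : ∀ x l → ¬ Linked (λ u w → rank u < rank w) (x ∷ l ∷ʳ x)
  ¬rank-increasing-closed = ¬Linked-closed <-trans (<-irrefl refl)

  ¬rank-decreasing-closed : ∀ x l → ¬ Linked (λ u w → rank w < rank u) (x ∷ l ∷ʳ x)
  ¬rank-decreasing-closed = ¬Linked-closed (λ p q → <-trans q p) (<-irrefl refl)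

  -- In a cycle the walk cannot descend all the way round, so it ends by ascending into its
  -- start x, from parent x; its first step cannot ascend either, so it also leaves x towards
  -- parent x, which is then visited twice.
  acyclic : ¬ HasCycle tree
  acyclic (x , []         , ()      , _)
  acyclic (x , _ ∷ []     , s≤s () , _)
  acyclic (x , y ∷ y′ ∷ ys , _ , distinct , links)
    with descends-or-ends-ascending (y′ ∷ ys ∷ʳ x) links (nonBacktracking-cycle ys distinct)
  ... | inj₁ descent = ¬rank-decreasing-closed x (y ∷ y′ ∷ ys) (Linked.map Child⇒rank< descent)
  ... | inj₂ ends-ascending with Edge⇒Child (Linked.head links)
  ...   | inj₂ y-child =
    ¬rank-increasing-closed x (y ∷ y′ ∷ ys)
      (Linked.map Child⇒rank<
         (ascent-continues (y′ ∷ ys ∷ʳ x) links (nonBacktracking-cycle ys distinct) y-child))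
  ...   | inj₁ (_ , px≡y) =
    Unique[x∷xs]⇒x∉xs (AllPairs.tail distinct)
      (Any.map (λ (_ , px≡u) → trans (sym px≡y) px≡u) (LastStep-∷ʳ y y′ ys ends-ascending))

  isTree : IsTree tree
  isTree = connected , acyclic

  count-isChildOf : ∀ c → count (isChildOf c) ≡ bit (not (c == root))
  count-isChildOf c with c ≟ root
  ... | yes _ = count-false {n} (λ _ → refl)
  ... | no _  = trans (count-cong (==-sym (parent c))) (count-singleton (parent c))

  degree-tree : ∀ u → degree tree u ≡ bit (not (u == root)) + count (λ c → isChildOf c u)
  degree-tree u =
    trans (degree≡count tree u)
          (trans (count-∨ (isChildOf u) (λ c → isChildOf c u) (isChildOf-asym u))
                 (cong (_+ count (λ c → isChildOf c u)) (count-isChildOf u)))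

true≢false : true ≢ false
true≢false ()

module _ {n} (G : Graph n) where

  adj-flip : ∀ {a b β} → adj G a b ≡ β → adj G b a ≡ β
  adj-flip {a} {b} = trans (adj-sym G b a)

  adj⇒≢ : ∀ {a b} → adj G a b ≡ true → a ≢ b
  adj⇒≢ {a} ab refl with () ← trans (sym ab) (adj-irrefl G a)

  adj-≢ : ∀ {a b c} → adj G a b ≡ true → adj G a c ≡ false → b ≢ c
  adj-≢ ab ac refl with () ← trans (sym ab) ac

  Edge⇒adj : ∀ {a b} → Edge G a b → adj G a b ≡ true
  Edge⇒adj = Equivalence.to T-≡

  adj⇒Edge : ∀ {a b} → adj G a b ≡ true → Edge G a b
  adj⇒Edge = Equivalence.from T-≡

  triangle-free⇒¬adj : TriangleFree G → ∀ {a b c} →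
                       adj G a b ≡ true → adj G b c ≡ true → adj G a c ≡ false
  triangle-free⇒¬adj triangle-free {a} {b} {c} ab bc with adj G a c in ac
  ... | false = refl
  ... | true  = ⊥-elim (triangle-free a b c (adj⇒Edge ab , adj⇒Edge bc , adj⇒Edge ac))

  complement-edge : ∀ {a b} → adj G a b ≡ false → a ≢ b → Edge (complement G) a b
  complement-edge ab a≢b rewrite ab | ==-≢ a≢b = tt

  complement-edge⁻ : ∀ {a b} → Edge (complement G) a b → adj G a b ≡ false × a ≢ b
  complement-edge⁻ {a} {b} e with adj G a b | a ≟ b
  ... | false | no a≢b = refl , a≢b

  odd-degree⇒neighbour : ∀ {u} → Odd (degree G u) → ∃[ w ] adj G u w ≡ true
  odd-degree⇒neighbour {u} odd with any? (λ w → adj G u w Bool.≟ true)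
  ... | yes found = found
  ... | no none
    with () ← subst Odd (trans (degree≡count G u) (count-false (λ w → ¬-not (λ e → none (w , e))))) odd

  ¬odd-two-neighbours : ∀ {u y z} → Odd (degree G u) → y ≢ z →
                        ¬ (∀ j → adj G u j ≡ (j == y) ∨ (j == z))
  ¬odd-two-neighbours {u} odd y≢z exactly
    with () ← subst Odd (trans (degree≡count G u) (trans (count-cong exactly) (count-pair y≢z))) odd

-- Odd spanning trees from a configuration

record Configuration {n} (G : Graph n) (v x p ℓ : Fin n) : Set where
  constructor configuration
  field
    v~x : adj G v x ≡ true
    p≢v : p ≢ v
    v≁p : adj G v p ≡ false
    ℓ≢v : ℓ ≢ v
    v≁ℓ : adj G v ℓ ≡ false
    p≢ℓ : p ≢ ℓ
    x≁p : adj G x p ≡ false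
    p≁ℓ : adj G p ℓ ≡ false

module ConfigurationTree {n} (G : Graph n) (triangle-free : TriangleFree G) (odd : AllDegreesOdd G)
                         {v x p ℓ : Fin n} (conf : Configuration G v x p ℓ) where

  open Configuration conf

  x≢v : x ≢ v
  x≢v = ≢-sym (adj⇒≢ G v~x)

  x≢ℓ : x ≢ ℓ
  x≢ℓ = adj-≢ G v~x v≁ℓ

  x≢p : x ≢ p
  x≢p = adj-≢ G v~x v≁p

  parent : Fin n → Fin n
  parent c = if (c == ℓ) ∨ (c == x) then p else if adj G v c then x else v

  rank : Fin n → ℕ
  rank c = if c == v then 0 else if (c == ℓ) ∨ (c == x) then 2 else if adj G v c then 3 else 1

  data Role : Fin n → Set where
    root : Role v
    leaf : Role ℓ
    hub  : Role x
    near : ∀ {c} → c ≢ x → adj G v c ≡ true → Role c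
    far  : ∀ {c} → c ≢ v → c ≢ ℓ → adj G v c ≡ false → Role c

  role : ∀ c → Role c
  role c with c ≟ v | c ≟ ℓ | c ≟ x | adj G v c in vc
  ... | yes refl | _        | _        | _     = root
  ... | no _     | yes refl | _        | _     = leaf
  ... | no _     | no _     | yes refl | _     = hub
  ... | no _     | no _     | no c≢x   | true  = near c≢x vc
  ... | no c≢v   | no c≢ℓ   | no _     | false = far c≢v c≢ℓ vc

  near≢v : ∀ {c} → adj G v c ≡ true → c ≢ v
  near≢v vc = ≢-sym (adj⇒≢ G vc)

  near≢ℓ : ∀ {c} → adj G v c ≡ true → c ≢ ℓ
  near≢ℓ vc = adj-≢ G vc v≁ℓ

  far≢x : ∀ {c} → adj G v c ≡ false → c ≢ x
  far≢x vc = ≢-sym (adj-≢ G v~x vc)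

  parent-leaf : parent ℓ ≡ p
  parent-leaf rewrite ==-refl ℓ = refl

  parent-hub : parent x ≡ p
  parent-hub rewrite ==-≢ x≢ℓ | ==-refl x = refl

  parent-near : ∀ {c} → c ≢ x → adj G v c ≡ true → parent c ≡ x
  parent-near c≢x vc rewrite ==-≢ (near≢ℓ vc) | ==-≢ c≢x | vc = refl

  parent-far : ∀ {c} → c ≢ ℓ → adj G v c ≡ false → parent c ≡ v
  parent-far c≢ℓ vc rewrite ==-≢ c≢ℓ | ==-≢ (far≢x vc) | vc = refl

  rank-root : rank v ≡ 0
  rank-root rewrite ==-refl v = refl

  rank-leaf : rank ℓ ≡ 2
  rank-leaf rewrite ==-≢ ℓ≢v | ==-refl ℓ = refl

  rank-hub : rank x ≡ 2
  rank-hub rewrite ==-≢ x≢v | ==-≢ x≢ℓ | ==-refl x = refl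

  rank-near : ∀ {c} → c ≢ x → adj G v c ≡ true → rank c ≡ 3
  rank-near c≢x vc rewrite ==-≢ (near≢v vc) | ==-≢ (near≢ℓ vc) | ==-≢ c≢x | vc = refl

  rank-far : ∀ {c} → c ≢ v → c ≢ ℓ → adj G v c ≡ false → rank c ≡ 1
  rank-far c≢v c≢ℓ vc rewrite ==-≢ c≢v | ==-≢ c≢ℓ | ==-≢ (far≢x vc) | vc = refl

  rank-p : rank p ≡ 1
  rank-p = rank-far p≢v p≢ℓ v≁p

  rank-parent : ∀ c → c ≢ v → rank (parent c) < rank c
  rank-parent c c≢v with role c
  ... | root = ⊥-elim (c≢v refl)
  ... | leaf rewrite parent-leaf | rank-p | rank-leaf = s≤s (s≤s z≤n)
  ... | hub  rewrite parent-hub  | rank-p | rank-hub  = s≤s (s≤s z≤n)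
  ... | near c≢x vc rewrite parent-near c≢x vc | rank-hub | rank-near c≢x vc = s≤s (s≤s (s≤s z≤n))
  ... | far c≢v c≢ℓ vc rewrite parent-far c≢ℓ vc | rank-root | rank-far c≢v c≢ℓ vc = s≤s z≤n

  open ParentTree v parent rank rank-parent

  nonadjacent-parent : ∀ c → c ≢ v → adj G c (parent c) ≡ false
  nonadjacent-parent c c≢v with role c
  ... | root = ⊥-elim (c≢v refl)
  ... | leaf rewrite parent-leaf = adj-flip G p≁ℓ
  ... | hub  rewrite parent-hub  = x≁p
  ... | near c≢x vc rewrite parent-near c≢x vc = triangle-free⇒¬adj G triangle-free (adj-flip G vc) v~x
  ... | far _ c≢ℓ vc rewrite parent-far c≢ℓ vc = adj-flip G vc

  Child⇒complement-edge : ∀ {c u} → Child c u → Edge (complement G) c u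
  Child⇒complement-edge {c} (c≢v , refl) =
    complement-edge G (nonadjacent-parent c c≢v)
                      (λ c≡pc → <-irrefl (cong rank (sym c≡pc)) (rank-parent c c≢v))

  spanning : SpanningSubgraph tree (complement G)
  spanning i j e with Edge⇒Child e
  ... | inj₁ i-child = Child⇒complement-edge i-child
  ... | inj₂ j-child = Edge-sym {G = complement G} (Child⇒complement-edge j-child)

  isChildOf-nonroot : ∀ {j} u → j ≢ v → isChildOf j u ≡ (parent j == u)
  isChildOf-nonroot u j≢v rewrite ==-≢ j≢v = refl

  nonNeighbour : Fin n → Bool
  nonNeighbour j = not (j == v) ∧ not (adj G v j)

  children-root : ∀ j → isChildOf j v ≡ nonNeighbour j ∧ not (j == ℓ)
  children-root j with role j
  ... | root rewrite ==-refl v = refl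
  ... | leaf rewrite isChildOf-nonroot v ℓ≢v | parent-leaf | ==-≢ p≢v
                   | ==-≢ ℓ≢v | v≁ℓ | ==-refl ℓ = refl
  ... | hub  rewrite isChildOf-nonroot v x≢v | parent-hub  | ==-≢ p≢v | ==-≢ x≢v | v~x = refl
  ... | near j≢x vj rewrite isChildOf-nonroot v (near≢v vj) | parent-near j≢x vj | ==-≢ x≢v
                          | ==-≢ (near≢v vj) | vj = refl
  ... | far j≢v j≢ℓ vj rewrite isChildOf-nonroot v j≢v | parent-far j≢ℓ vj | ==-refl v
                             | ==-≢ j≢v | vj | ==-≢ j≢ℓ = refl

  children-p : ∀ j → isChildOf j p ≡ (j == ℓ) ∨ (j == x)
  children-p j with role j
  ... | root rewrite ==-refl v | ==-≢ (≢-sym ℓ≢v) | ==-≢ (≢-sym x≢v) = refl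
  ... | leaf rewrite isChildOf-nonroot p ℓ≢v | parent-leaf | ==-refl p | ==-refl ℓ = refl
  ... | hub  rewrite isChildOf-nonroot p x≢v | parent-hub  | ==-refl p | ==-≢ x≢ℓ | ==-refl x = refl
  ... | near j≢x vj rewrite isChildOf-nonroot p (near≢v vj) | parent-near j≢x vj | ==-≢ x≢p
                          | ==-≢ (near≢ℓ vj) | ==-≢ j≢x = refl
  ... | far j≢v j≢ℓ vj rewrite isChildOf-nonroot p j≢v | parent-far j≢ℓ vj | ==-≢ (≢-sym p≢v)
                             | ==-≢ j≢ℓ | ==-≢ (far≢x vj) = refl

  children-hub : ∀ j → isChildOf j x ≡ adj G v j ∧ not (j == x)
  children-hub j with role j
  ... | root rewrite ==-refl v | adj-irrefl G v = refl
  ... | leaf rewrite isChildOf-nonroot x ℓ≢v | parent-leaf | ==-≢ (≢-sym x≢p) | v≁ℓ = refl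
  ... | hub  rewrite isChildOf-nonroot x x≢v | parent-hub  | ==-≢ (≢-sym x≢p)
                   | v~x | ==-refl x = refl
  ... | near j≢x vj rewrite isChildOf-nonroot x (near≢v vj) | parent-near j≢x vj | ==-refl x
                          | vj | ==-≢ j≢x = refl
  ... | far j≢v j≢ℓ vj rewrite isChildOf-nonroot x j≢v | parent-far j≢ℓ vj
                             | ==-≢ (≢-sym x≢v) | vj = refl

  childless : ∀ {u} → u ≢ v → u ≢ p → u ≢ x → ∀ j → isChildOf j u ≡ false
  childless {u} u≢v u≢p u≢x j with role j
  ... | root rewrite ==-refl v = refl
  ... | leaf rewrite isChildOf-nonroot u ℓ≢v | parent-leaf = ==-≢ (≢-sym u≢p)
  ... | hub  rewrite isChildOf-nonroot u x≢v | parent-hub  = ==-≢ (≢-sym u≢p)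
  ... | near j≢x vj rewrite isChildOf-nonroot u (near≢v vj) | parent-near j≢x vj = ==-≢ (≢-sym u≢x)
  ... | far j≢v j≢ℓ vj rewrite isChildOf-nonroot u j≢v | parent-far j≢ℓ vj = ==-≢ (≢-sym u≢v)

  parity-degree-v : parity (count (adj G v)) ≡ 1ℙ
  parity-degree-v = subst (λ k → parity k ≡ 1ℙ) (degree≡count G v) (Odd⇒parity≡1 (degree G v) (odd v))

  order-split : suc (count (adj G v)) + count nonNeighbour ≡ n
  order-split = begin
    suc (count (adj G v)) + count nonNeighbour       ≡⟨ cong₂ _+_ (sym closed-count) (count-cong de-Morgan) ⟩
    count closed + count (not ∘ closed)               ≡⟨ count-complement closed ⟩
    n                                                 ∎
    where
    open ≡-Reasoning
    closed : Fin n → Bool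
    closed j = (j == v) ∨ adj G v j
    disjoint : ∀ j → (j == v) ∧ adj G v j ≡ false
    disjoint j with j ≟ v
    ... | yes refl = adj-irrefl G v
    ... | no _     = refl
    closed-count : count closed ≡ suc (count (adj G v))
    closed-count = trans (count-∨ (_== v) (adj G v) disjoint) (cong (_+ count (adj G v)) (count-singleton v))
    de-Morgan : ∀ j → nonNeighbour j ≡ not (closed j)
    de-Morgan j with j == v | adj G v j
    ... | true  | _     = refl
    ... | false | true  = refl
    ... | false | false = refl

  -- n is even and deg v is odd, so v has an even number of non-neighbours; all but ℓ are its children.
  parity-children-root : parity (count (λ j → nonNeighbour j ∧ not (j == ℓ))) ≡ 1ℙ
  parity-children-root =
    trans (sym (parity-suc-injective d c (even-+⇒≡parity (suc d) (suc c) even))) parity-degree-v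
    where
    d c : ℕ
    d = count (adj G v)
    c = count (λ j → nonNeighbour j ∧ not (j == ℓ))
    nonNeighbour-ℓ : nonNeighbour ℓ ≡ true
    nonNeighbour-ℓ rewrite ==-≢ ℓ≢v | v≁ℓ = refl
    even : parity (suc d + suc c) ≡ 0ℙ
    even = subst (λ m → parity (suc d + m) ≡ 0ℙ) (count-remove nonNeighbour nonNeighbour-ℓ)
                 (subst (λ k → parity k ≡ 0ℙ) (sym order-split) (even-order G odd))

  parity-degree-tree : ∀ u → parity (bit (not (u == v)) + count (λ c → isChildOf c u)) ≡ 1ℙ
  parity-degree-tree u with u ≟ v | u ≟ p | u ≟ x
  ... | yes refl | _        | _        = trans (cong parity (count-cong children-root)) parity-children-root
  ... | no _     | yes refl | _        = cong (λ k → parity (suc k))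
                                             (trans (count-cong children-p) (count-pair (≢-sym x≢ℓ)))
  ... | no _     | no _     | yes refl = begin
    parity (suc (count (λ c → isChildOf c x)))             ≡⟨ cong (parity ∘ suc) (count-cong children-hub) ⟩
    parity (suc (count (λ c → adj G v c ∧ not (c == x))))  ≡⟨ cong parity (count-remove (adj G v) v~x) ⟨
    parity (count (adj G v))                               ≡⟨ parity-degree-v ⟩
    1ℙ                                                     ∎
    where open ≡-Reasoning
  ... | no u≢v   | no u≢p   | no u≢x   = cong (λ k → parity (suc k)) (count-false (childless u≢v u≢p u≢x))

  oddSpanningTree : HasOddSpanningTree (complement G)
  oddSpanningTree = tree , spanning , isTree , odd-degree
    where
    odd-degree : AllDegreesOdd tree
    odd-degree u = parity≡1⇒Odd (degree tree u)
                     (subst (λ k → parity k ≡ 1ℙ) (sym (degree-tree u)) (parity-degree-tree u))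

isomorphic-by-enumeration : ∀ {m n} {G : Graph n} {H : Graph m} (f : Fin m → Fin n) (g : Fin n → Fin m) →
  (∀ k → g (f k) ≡ k) → (∀ j → ∃[ k ] f k ≡ j) → (∀ k l → adj G (f k) (f l) ≡ adj H k l) →
  Isomorphic G H
isomorphic-by-enumeration {G = G} {H} f g g∘f enumerates f-adj = ↔⇒⤖ (mk↔ₛ′ g f g∘f f∘g) , adj-g
  where
  f∘g : ∀ j → f (g j) ≡ j
  f∘g j with enumerates j
  ... | k , refl = cong f (g∘f k)
  adj-g : ∀ i j → adj G i j ≡ adj H (g i) (g j)
  adj-g i j = trans (sym (cong₂ (adj G) (f∘g i) (f∘g j))) (f-adj (g i) (g j))

isInj₁ : ∀ {A B : Set} → A ⊎ B → Bool
isInj₁ (inj₁ _) = true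
isInj₁ (inj₂ _) = false

module _ {n s t : ℕ} where

  cons : ∀ b → (Fin n → Fin s ⊎ Fin t) → Fin (suc n) → Fin (bit b + s) ⊎ Fin (bit (not b) + t)
  cons true  h zero    = inj₁ zero
  cons false h zero    = inj₂ zero
  cons true  h (suc i) = Sum.map suc id (h i)
  cons false h (suc i) = Sum.map id suc (h i)

  uncons : ∀ b → (Fin s ⊎ Fin t → Fin n) → Fin (bit b + s) ⊎ Fin (bit (not b) + t) → Fin (suc n)
  uncons true  h (inj₁ zero)    = zero
  uncons true  h (inj₁ (suc k)) = suc (h (inj₁ k))
  uncons true  h (inj₂ k)       = suc (h (inj₂ k))
  uncons false h (inj₁ k)       = suc (h (inj₁ k))
  uncons false h (inj₂ zero)    = zero
  uncons false h (inj₂ (suc k)) = suc (h (inj₂ k))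

  uncons-cons : ∀ b {h h′} → (∀ i → h′ (h i) ≡ i) → ∀ i → uncons b h′ (cons b h i) ≡ i
  uncons-cons true  inv zero    = refl
  uncons-cons false inv zero    = refl
  uncons-cons true {h} inv (suc i) with h i | inv i
  ... | inj₁ _ | eq = cong suc eq
  ... | inj₂ _ | eq = cong suc eq
  uncons-cons false {h} inv (suc i) with h i | inv i
  ... | inj₁ _ | eq = cong suc eq
  ... | inj₂ _ | eq = cong suc eq

  cons-uncons : ∀ b {h h′} → (∀ y → h (h′ y) ≡ y) → ∀ y → cons b h (uncons b h′ y) ≡ y
  cons-uncons true  inv (inj₁ zero)    = refl
  cons-uncons true  inv (inj₁ (suc k)) = cong (Sum.map suc id) (inv (inj₁ k))
  cons-uncons true  inv (inj₂ k)       = cong (Sum.map suc id) (inv (inj₂ k))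
  cons-uncons false inv (inj₁ k)       = cong (Sum.map id suc) (inv (inj₁ k))
  cons-uncons false inv (inj₂ zero)    = refl
  cons-uncons false inv (inj₂ (suc k)) = cong (Sum.map id suc) (inv (inj₂ k))

  isInj₁-cons : ∀ b (h : Fin n → Fin s ⊎ Fin t) i → isInj₁ (cons b h (suc i)) ≡ isInj₁ (h i)
  isInj₁-cons true  h i with h i
  ... | inj₁ _ = refl
  ... | inj₂ _ = refl
  isInj₁-cons false h i with h i
  ... | inj₁ _ = refl
  ... | inj₂ _ = refl

split : ∀ {n} (P : Fin n → Bool) → Fin n → Fin (count P) ⊎ Fin (count (not ∘ P))
split {suc n} P = cons (P zero) (split (P ∘ suc))

merge : ∀ {n} (P : Fin n → Bool) → Fin (count P) ⊎ Fin (count (not ∘ P)) → Fin n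
merge {zero}  P (inj₁ ())
merge {zero}  P (inj₂ ())
merge {suc n} P = uncons (P zero) (merge (P ∘ suc))

merge-split : ∀ {n} (P : Fin n → Bool) i → merge P (split P i) ≡ i
merge-split {suc n} P = uncons-cons (P zero) (merge-split (P ∘ suc))

split-merge : ∀ {n} (P : Fin n → Bool) y → split P (merge P y) ≡ y
split-merge {zero}  P (inj₁ ())
split-merge {zero}  P (inj₂ ())
split-merge {suc n} P = cons-uncons (P zero) (split-merge (P ∘ suc))

isInj₁-split : ∀ {n} (P : Fin n → Bool) i → isInj₁ (split P i) ≡ P i
isInj₁-split {suc n} P zero    with P zero
... | true  = refl
... | false = refl
isInj₁-split {suc n} P (suc i) =
  trans (isInj₁-cons (P zero) (split (P ∘ suc)) i) (isInj₁-split (P ∘ suc) i)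

m+n<ᵇm≡false : ∀ m n → (m + n <ᵇ m) ≡ false
m+n<ᵇm≡false zero    n = refl
m+n<ᵇm≡false (suc m) n = m+n<ᵇm≡false m n

bipartition⇒completeBipartite : ∀ {n} (G : Graph n) (P : Fin n → Bool) →
                                (∀ i j → adj G i j ≡ P i xor P j) →
                                1 ≤ count P → 1 ≤ count (not ∘ P) → IsCompleteBipartite G
bipartition⇒completeBipartite {n} G P adj≡xor 1≤s 1≤t =
  s , t , 1≤s , 1≤t , ↔⇒⤖ (mk↔ₛ′ g f g∘f f∘g) , adj-g
  where
  s t : ℕ
  s = count P
  t = count (not ∘ P)
  g : Fin n → Fin (s + t)
  g i = join s t (split P i)
  f : Fin (s + t) → Fin n
  f k = merge P (splitAt s k)
  g∘f : ∀ k → g (f k) ≡ k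
  g∘f k = trans (cong (join s t) (split-merge P (splitAt s k))) (join-splitAt s t k)
  f∘g : ∀ i → f (g i) ≡ i
  f∘g i = trans (cong (merge P) (splitAt-join s t (split P i))) (merge-split P i)
  side-join : ∀ y → (toℕ (join s t y) <ᵇ s) ≡ isInj₁ y
  side-join (inj₁ k) = trans (cong (_<ᵇ s) (toℕ-↑ˡ k t)) (Equivalence.to T-≡ (<⇒<ᵇ (toℕ<n k)))
  side-join (inj₂ k) = trans (cong (_<ᵇ s) (toℕ-↑ʳ s k)) (m+n<ᵇm≡false s (toℕ k))
  side-g : ∀ i → (toℕ (g i) <ᵇ s) ≡ P i
  side-g i = trans (side-join (split P i)) (isInj₁-split P i)
  adj-g : ∀ i j → adj G i j ≡ adj (completeBipartite s t) (g i) (g j)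
  adj-g i j = trans (adj≡xor i j) (sym (cong₂ _xor_ (side-g i) (side-g j)))

-- Complements without odd spanning trees

complement-completeBipartite-disconnected : ∀ {n} (G : Graph n) → IsCompleteBipartite G →
  ∀ {S} → SpanningSubgraph S (complement G) → ¬ Connected S
complement-completeBipartite-disconnected {n} G (suc s , suc t , _ , _ , f , f-adj) {S} spanning connected
  with Bijection.strictlySurjective f zero | Bijection.strictlySurjective f (suc s ↑ʳ zero)
... | a , to-a | b , to-b = true≢false (trans (sym (same-side (connected a b))) side-b)
  where
  open Bijection f using (to)
  side : Fin n → Bool
  side i = toℕ (to i) <ᵇ suc s
  side-a : side a ≡ true
  side-a rewrite to-a = refl
  side-b : side b ≡ false
  side-b = trans (cong (λ k → toℕ k <ᵇ suc s) to-b)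
                 (trans (cong (_<ᵇ suc s) (toℕ-↑ʳ (suc s) (zero {t}))) (m+n<ᵇm≡false (suc s) 0))
  stays-left : ∀ {i j} → side i ≡ true → Edge S i j → side j ≡ true
  stays-left {i} {j} left e = not-injective (begin
    not (side j)        ≡⟨ cong (_xor side j) left ⟨
    side i xor side j   ≡⟨ f-adj i j ⟨
    adj G i j           ≡⟨ proj₁ (complement-edge⁻ G (spanning i j e)) ⟩
    false               ∎)
    where open ≡-Reasoning
  same-side : ∀ {j} → Walk S a j → side j ≡ true
  same-side = walk-preserves (λ j → side j ≡ true) stays-left side-a

-- The complement of 2K₂ is the 4-cycle 0 2 1 3, which is bipartite with sides {0, 1} and {2, 3}.
inner : Fin 4 → Bool
inner 0F = true
inner 1F = true
inner 2F = false
inner 3F = false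

twoK2-nonadjacent⇒crossing : ∀ k l → adj twoK2 k l ≡ false → k ≢ l → inner l ≡ not (inner k)
twoK2-nonadjacent⇒crossing 0F 0F _  k≢l = ⊥-elim (k≢l refl)
twoK2-nonadjacent⇒crossing 0F 1F () _
twoK2-nonadjacent⇒crossing 0F 2F _  _   = refl
twoK2-nonadjacent⇒crossing 0F 3F _  _   = refl
twoK2-nonadjacent⇒crossing 1F 0F () _
twoK2-nonadjacent⇒crossing 1F 1F _  k≢l = ⊥-elim (k≢l refl)
twoK2-nonadjacent⇒crossing 1F 2F _  _   = refl
twoK2-nonadjacent⇒crossing 1F 3F _  _   = refl
twoK2-nonadjacent⇒crossing 2F 0F _  _   = refl
twoK2-nonadjacent⇒crossing 2F 1F _  _   = refl
twoK2-nonadjacent⇒crossing 2F 2F _  k≢l = ⊥-elim (k≢l refl)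
twoK2-nonadjacent⇒crossing 2F 3F () _
twoK2-nonadjacent⇒crossing 3F 0F _  _   = refl
twoK2-nonadjacent⇒crossing 3F 1F _  _   = refl
twoK2-nonadjacent⇒crossing 3F 2F () _
twoK2-nonadjacent⇒crossing 3F 3F _  k≢l = ⊥-elim (k≢l refl)

-- With a and b the vertices sent to 0 and 1, the vertex a together with its neighbours in a
-- spanning tree S of the complement is closed under S: each such neighbour lies on the other side,
-- so its S-neighbours are among a and b, and it cannot have both, which would make its degree 2.
complement-twoK2-¬oddSpanningTree : ∀ {n} (G : Graph n) → Isomorphic G twoK2 →
                                    ¬ HasOddSpanningTree (complement G)
complement-twoK2-¬oddSpanningTree {n} G (f , f-adj) (S , spanning , (connected , _) , odd) =
  b-outside (walk-preserves Component closed (inj₁ refl) (connected a b))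
  where
  open Bijection f using (to; injective; strictlySurjective)
  a b : Fin n
  a = proj₁ (strictlySurjective 0F)
  b = proj₁ (strictlySurjective 1F)
  to-a : to a ≡ 0F
  to-a = proj₂ (strictlySurjective 0F)
  to-b : to b ≡ 1F
  to-b = proj₂ (strictlySurjective 1F)
  b≢a : b ≢ a
  b≢a b≡a with () ← trans (sym to-b) (trans (cong to b≡a) to-a)

  crossing : ∀ {i j} → Edge S i j → inner (to j) ≡ not (inner (to i))
  crossing {i} {j} e with complement-edge⁻ G (spanning i j e)
  ... | i≁j , i≢j = twoK2-nonadjacent⇒crossing (to i) (to j) (trans (sym (f-adj i j)) i≁j) (i≢j ∘ injective)

  inner⇒a-or-b : ∀ j → inner (to j) ≡ true → j ≡ a ⊎ j ≡ b
  inner⇒a-or-b j inner-j with to j in to-j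
  ... | 0F = inj₁ (injective (trans to-j (sym to-a)))
  ... | 1F = inj₂ (injective (trans to-j (sym to-b)))
  ... | 2F with () ← inner-j
  ... | 3F with () ← inner-j

  inner-a : inner (to a) ≡ true
  inner-a = cong inner to-a

  inner-second-step : ∀ {i j} → Edge S a i → Edge S i j → inner (to j) ≡ true
  inner-second-step a~i i~j rewrite crossing i~j | crossing a~i | inner-a = refl

  Component : Fin n → Set
  Component j = j ≡ a ⊎ Edge S a j

  b-outside : ¬ Component b
  b-outside (inj₁ b≡a) = b≢a b≡a
  b-outside (inj₂ a~b) with () ← trans (sym (cong inner to-b)) (trans (crossing a~b) (cong not inner-a))

  closed : ∀ {i j} → Component i → Edge S i j → Component j
  closed (inj₁ refl) a~j = inj₂ a~j
  closed (inj₂ a~i) i~j = inj₁ (back-to-a a~i i~j)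
    where
    back-to-a : ∀ {i j} → Edge S a i → Edge S i j → j ≡ a
    back-to-a {i} {j} a~i i~j with inner⇒a-or-b j (inner-second-step a~i i~j)
    ... | inj₁ j≡a  = j≡a
    ... | inj₂ refl = ⊥-elim (¬odd-two-neighbours S (odd i) (≢-sym b≢a) exactly)
      where
      exactly : ∀ k → adj S i k ≡ (k == a) ∨ (k == b)
      exactly k with adj S i k in i~k
      ... | true with inner⇒a-or-b k (inner-second-step a~i (adj⇒Edge S i~k))
      ...   | inj₁ refl rewrite ==-refl a = refl
      ...   | inj₂ refl rewrite ==-≢ b≢a | ==-refl b = refl
      exactly k | false with k ≟ a | k ≟ b
      ... | yes refl | _        with () ← trans (sym i~k) (Edge⇒adj S (Edge-sym {G = S} a~i))
      ... | no _     | yes refl with () ← trans (sym i~k) (Edge⇒adj S i~j)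
      ... | no _     | no _     = refl

-- Graphs without configurations

twoK2-by-enumeration : ∀ {n} (G : Graph n) {v x p w} → p ≢ v → p ≢ x →
  adj G v x ≡ true → adj G p w ≡ true →
  adj G v p ≡ false → adj G v w ≡ false → adj G x p ≡ false → adj G x w ≡ false →
  (∀ j → j ≡ v ⊎ j ≡ x ⊎ j ≡ p ⊎ j ≡ w) → Isomorphic G twoK2
twoK2-by-enumeration {n} G {v} {x} {p} {w} p≢v p≢x v~x p~w v≁p v≁w x≁p x≁w cover =
  isomorphic-by-enumeration {G = G} {H = twoK2} table decode decode-table enumerates table-adj
  where
  x≢v : x ≢ v
  x≢v = ≢-sym (adj⇒≢ G v~x)
  w≢p : w ≢ p
  w≢p = ≢-sym (adj⇒≢ G p~w)
  w≢v : w ≢ v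
  w≢v = adj-≢ G p~w (adj-flip G v≁p)
  w≢x : w ≢ x
  w≢x = adj-≢ G p~w (adj-flip G x≁p)
  table : Fin 4 → Fin n
  table 0F = v
  table 1F = x
  table 2F = p
  table 3F = w
  decode : Fin n → Fin 4
  decode j = if j == v then 0F else if j == x then 1F else if j == p then 2F else 3F
  decode-table : ∀ k → decode (table k) ≡ k
  decode-table 0F rewrite ==-refl v = refl
  decode-table 1F rewrite ==-≢ x≢v | ==-refl x = refl
  decode-table 2F rewrite ==-≢ p≢v | ==-≢ p≢x | ==-refl p = refl
  decode-table 3F rewrite ==-≢ w≢v | ==-≢ w≢x | ==-≢ w≢p = refl
  enumerates : ∀ j → ∃[ k ] table k ≡ j
  enumerates j with cover j
  ... | inj₁ refl               = 0F , refl
  ... | inj₂ (inj₁ refl)        = 1F , refl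
  ... | inj₂ (inj₂ (inj₁ refl)) = 2F , refl
  ... | inj₂ (inj₂ (inj₂ refl)) = 3F , refl
  table-adj : ∀ k l → adj G (table k) (table l) ≡ adj twoK2 k l
  table-adj 0F 0F = adj-irrefl G v
  table-adj 0F 1F = v~x
  table-adj 0F 2F = v≁p
  table-adj 0F 3F = v≁w
  table-adj 1F 0F = adj-flip G v~x
  table-adj 1F 1F = adj-irrefl G x
  table-adj 1F 2F = x≁p
  table-adj 1F 3F = x≁w
  table-adj 2F 0F = adj-flip G v≁p
  table-adj 2F 1F = adj-flip G x≁p
  table-adj 2F 2F = adj-irrefl G p
  table-adj 2F 3F = p~w
  table-adj 3F 0F = adj-flip G v≁w
  table-adj 3F 1F = adj-flip G x≁w
  table-adj 3F 2F = adj-flip G p~w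
  table-adj 3F 3F = adj-irrefl G w

EdgesDominate : ∀ {n} → Graph n → Set
EdgesDominate G = ∀ {v x p} → adj G v x ≡ true → p ≢ v → p ≢ x →
                  adj G v p ≡ false → adj G x p ≡ false → ⊥

edgesDominate⇒completeBipartite : ∀ {n} (G : Graph n) → TriangleFree G → EdgesDominate G →
                                  ∀ {v x} → adj G v x ≡ true → IsCompleteBipartite G
edgesDominate⇒completeBipartite G triangle-free dominate {v} {x} v~x =
  bipartition⇒completeBipartite G (adj G x) adj≡xor
    (subst (1 ≤_) (sym (count-remove (adj G x) (adj-flip G v~x))) (s≤s z≤n))
    (subst (1 ≤_) (sym (count-remove (not ∘ adj G x) (cong not (adj-irrefl G x)))) (s≤s z≤n))
  where
  ¬triangle : ∀ {a b c} → adj G a b ≡ true → adj G b c ≡ true → adj G a c ≡ false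
  ¬triangle = triangle-free⇒¬adj G triangle-free
  adj≡xor : ∀ i j → adj G i j ≡ adj G x i xor adj G x j
  adj≡xor i j with adj G i j in i~j | adj G x i in x~i | adj G x j in x~j
  ... | true  | true  | false = refl
  ... | true  | false | true  = refl
  ... | false | true  | true  = refl
  ... | false | false | false = refl
  ... | true  | true  | true  = ⊥-elim (true≢false (trans (sym x~j) (¬triangle x~i i~j)))
  ... | true  | false | false = ⊥-elim (dominate i~j x≢i x≢j (adj-flip G x~i) (adj-flip G x~j))
    where
    x≢i : x ≢ i
    x≢i refl = true≢false (trans (sym i~j) x~j)
    x≢j : x ≢ j
    x≢j refl = true≢false (trans (sym (adj-flip G i~j)) x~i)
  ... | false | true  | false = ⊥-elim (dominate (adj-flip G x~i) j≢i j≢x i~j x~j)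
    where
    j≢x : j ≢ x
    j≢x refl = true≢false (trans (sym x~i) (adj-flip G i~j))
    j≢i : j ≢ i
    j≢i refl = true≢false (trans (sym x~i) x~j)
  ... | false | false | true  = ⊥-elim (dominate (adj-flip G x~j) i≢j i≢x (adj-flip G i~j) x~i)
    where
    i≢x : i ≢ x
    i≢x refl = true≢false (trans (sym x~j) i~j)
    i≢j : i ≢ j
    i≢j refl = true≢false (trans (sym x~j) x~i)

module NoConfiguration {n} (G : Graph n) (triangle-free : TriangleFree G) (odd : AllDegreesOdd G)
                       (none : ∀ {v x p ℓ} → ¬ Configuration G v x p ℓ) where

  ¬triangle : ∀ {a b c} → adj G a b ≡ true → adj G b c ≡ true → adj G a c ≡ false
  ¬triangle = triangle-free⇒¬adj G triangle-free

  module Undominated {v x p} (v~x : adj G v x ≡ true) (p≢v : p ≢ v) (p≢x : p ≢ x)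
                     (v≁p : adj G v p ≡ false) (x≁p : adj G x p ≡ false) where

    Outside : Fin n → Set
    Outside w = w ≢ p × w ≢ v × w ≢ x

    outside-adj-p : ∀ {w} → Outside w → adj G p w ≡ true
    outside-adj-p {w} (w≢p , w≢v , w≢x) with adj G p w in p~w | adj G v w in v~w
    ... | true  | _     = refl
    ... | false | false = ⊥-elim (none (configuration v~x p≢v v≁p w≢v v~w (≢-sym w≢p) x≁p p~w))
    ... | false | true  = ⊥-elim (none (configuration (adj-flip G v~x) p≢x x≁p w≢x
                                                      (¬triangle (adj-flip G v~x) v~w) (≢-sym w≢p) v≁p p~w))

    outside-independent : ∀ {w w′} → Outside w → Outside w′ → adj G w w′ ≡ false
    outside-independent o o′ = ¬triangle (adj-flip G (outside-adj-p o)) (outside-adj-p o′)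

    -- An outside neighbour of v would have exactly the two neighbours p and v.
    outside-≁v : ∀ {w} → Outside w → adj G w v ≡ false
    outside-≁v {w} o with adj G w v in w~v
    ... | false = refl
    ... | true  = ⊥-elim (¬odd-two-neighbours G (odd w) p≢v exactly)
      where
      exactly : ∀ j → adj G w j ≡ (j == p) ∨ (j == v)
      exactly j with j ≟ p | j ≟ v | j ≟ x
      ... | yes refl | _        | _        = adj-flip G (outside-adj-p o)
      ... | no _     | yes refl | _        = w~v
      ... | no _     | no _     | yes refl = ¬triangle w~v v~x
      ... | no j≢p   | no j≢v   | no j≢x   = outside-independent o (j≢p , j≢v , j≢x)

    neighbour-of-p-outside : ∀ {w} → adj G p w ≡ true → Outside w
    neighbour-of-p-outside p~w =
      ≢-sym (adj⇒≢ G p~w) , adj-≢ G p~w (adj-flip G v≁p) , adj-≢ G p~w (adj-flip G x≁p)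

  noConfiguration⇒edgesDominate : ¬ Isomorphic G twoK2 → EdgesDominate G
  noConfiguration⇒edgesDominate ¬twoK2 {v} {x} {p} v~x p≢v p≢x v≁p x≁p =
    fourth-or-fifth-vertex (odd-degree⇒neighbour G (odd p))
    where
    open Undominated v~x p≢v p≢x v≁p x≁p
    outside-≁x : ∀ {w} → Outside w → adj G w x ≡ false
    outside-≁x (w≢p , w≢v , w≢x) =
      Undominated.outside-≁v (adj-flip G v~x) p≢x p≢v x≁p v≁p (w≢p , w≢x , w≢v)
    -- A neighbour w of p and a fifth vertex w′ form the configuration (w, p, v, w′); without a
    -- fifth vertex G is the matching v x, p w.
    fourth-or-fifth-vertex : ∃[ w ] adj G p w ≡ true → ⊥
    fourth-or-fifth-vertex (w , p~w)
      with any? (λ j → ¬? (j ≟ p) ×-dec ¬? (j ≟ v) ×-dec ¬? (j ≟ x) ×-dec ¬? (j ≟ w))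
    ... | yes (w′ , w′≢p , w′≢v , w′≢x , w′≢w) =
      none (configuration (adj-flip G p~w) (≢-sym w≢v) (outside-≁v w-outside) w′≢w
                          (outside-independent w-outside w′-outside) (≢-sym w′≢v) (adj-flip G v≁p)
                          (adj-flip G (outside-≁v w′-outside)))
      where
      w-outside : Outside w
      w-outside = neighbour-of-p-outside p~w
      w≢v : w ≢ v
      w≢v = proj₁ (proj₂ w-outside)
      w′-outside : Outside w′
      w′-outside = w′≢p , w′≢v , w′≢x
    ... | no fifth =
      ¬twoK2 (twoK2-by-enumeration G p≢v p≢x v~x p~w v≁p (adj-flip G (outside-≁v w-outside))
                                   x≁p (adj-flip G (outside-≁x w-outside)) four)
      where
      w-outside : Outside w
      w-outside = neighbour-of-p-outside p~w
      four : ∀ j → j ≡ v ⊎ j ≡ x ⊎ j ≡ p ⊎ j ≡ w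
      four j with j ≟ v | j ≟ x | j ≟ p | j ≟ w
      ... | yes j≡v | _       | _       | _       = inj₁ j≡v
      ... | no _    | yes j≡x | _       | _       = inj₂ (inj₁ j≡x)
      ... | no _    | no _    | yes j≡p | _       = inj₂ (inj₂ (inj₁ j≡p))
      ... | no _    | no _    | no _    | yes j≡w = inj₂ (inj₂ (inj₂ j≡w))
      ... | no j≢v  | no j≢x  | no j≢p  | no j≢w  = ⊥-elim (fifth (j , j≢p , j≢v , j≢x , j≢w))

configuration? : ∀ {n} (G : Graph n) v x p ℓ → Dec (Configuration G v x p ℓ)
configuration? G v x p ℓ =
  map′ (λ (a , b , c , d , e , f , g , h) → configuration a b c d e f g h)
       (λ (configuration a b c d e f g h) → a , b , c , d , e , f , g , h)
       (adj G v x Bool.≟ true ×-dec ¬? (p ≟ v) ×-dec adj G v p Bool.≟ false ×-dec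
        ¬? (ℓ ≟ v) ×-dec adj G v ℓ Bool.≟ false ×-dec ¬? (p ≟ ℓ) ×-dec
        adj G x p Bool.≟ false ×-dec adj G p ℓ Bool.≟ false)

oddSpanningTree-of-complement : ∀ {n} (G : Graph n) → TriangleFree G → AllDegreesOdd G →
  ¬ Isomorphic G twoK2 → ¬ IsCompleteBipartite G → HasOddSpanningTree (complement G)
oddSpanningTree-of-complement {zero} G _ _ _ _ =
  record { adj = λ () ; sym = λ () ; irrefl = λ () } , (λ ()) , ((λ ()) , λ { (() , _) }) , λ ()
oddSpanningTree-of-complement {suc n} G triangle-free odd ¬twoK2 ¬completeBipartite
  with any? (λ v → any? (λ x → any? (λ p → any? (configuration? G v x p))))
... | yes (_ , _ , _ , _ , conf) = ConfigurationTree.oddSpanningTree G triangle-free odd conf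
... | no none = ⊥-elim (¬completeBipartite (edgesDominate⇒completeBipartite G triangle-free dominate
                                             (proj₂ (odd-degree⇒neighbour G (odd zero)))))
  where
  dominate : EdgesDominate G
  dominate = NoConfiguration.noConfiguration⇒edgesDominate G triangle-free odd
               (λ conf → none (_ , _ , _ , _ , conf)) ¬twoK2

theorem4p2 : ∀ {n : ℕ} (G : Graph n) → TriangleFree G → AllDegreesOdd G →
    (HasOddSpanningTree (complement G) ⇔ (¬ Isomorphic G twoK2 × ¬ IsCompleteBipartite G))
theorem4p2 G triangle-free odd = mk⇔ necessary sufficient
  where
  necessary : HasOddSpanningTree (complement G) → ¬ Isomorphic G twoK2 × ¬ IsCompleteBipartite G
  necessary tree@(_ , spanning , (connected , _) , _) =
    (λ iso → complement-twoK2-¬oddSpanningTree G iso tree) ,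
    (λ cb → complement-completeBipartite-disconnected G cb spanning connected)
  sufficient : ¬ Isomorphic G twoK2 × ¬ IsCompleteBipartite G → HasOddSpanningTree (complement G)
  sufficient (¬twoK2 , ¬cb) = oddSpanningTree-of-complement G triangle-free odd ¬twoK2 ¬cb
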